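{- Let $k\ge 3$ and let $x\in\{0,1\}^{N_k}$ be such that each column $C_1,\dots,C_{b_k}$ of $x$ is sorted. Let $c_i=ones(x_{C_i})$ and $\overline{c}=(c_1,\dots,c_{b_k})$. For $j=1,2,3$ let $y_j=T^k_j(x)$, $d_{j,i}=ones((y_j)_{C_i})$ and $\overline{d_j}=(d_{j,1},\dots,d_{j,b_k})$. Then $Q^k_j(\overline{c})=\overline{d_j}$ for $j=1,2,3$.
   Context: Let $n_k=2^{k-1}-1$, $b_k=2(k-2)$, $N_k=n_kb_k$; registers $1,\dots,N_k$, content $x=(x_1,\dots,x_{N_k})$. A comparator $[a:b]$ ($a<b$) replaces $(x_a,x_b)$ by $(\min,\max)$. Define $S_{k,1}=\{[b_ki:b_ki+1]: i=1,\dots,n_k-1\}$ and for $j=1,\dots,k-2$: $S_{k,2j}=\{[b_ki+j:\ b_k(i+2^{k-j-1}-1)+b_k-j+1]: i=0,\dots,n_k-2^{k-j-1}\}$, $S_{k,2j+1}=\{[b_ki+j:b_ki+j+1],\ [b_ki+b_k-j:b_ki+b_k-j+1]: i=0,\dots,n_k-1\}$. For $r=1,2,3$, $T^k_r=\bigcup\{S_{k,m}:1\le m\le 2k-3,\ m\equiv r \pmod 3\}$; its comparators act on disjoint register pairs and $T^k_r(x)$ is the result of applying them all simultaneously. Columns: $C_j=\{j+ib_k: 0\le i\le n_k-1\}$; $x_{C_j}$ is the subword of $x$ on $C_j$ in increasing order; a column is sorted if $x_{C_j}$ is of the form $0^*1^*$; $ones(w)$ is the number of $1$s in $w$. Let $h_i=2^{k-i-1}-1$.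 For $\overline{c}\in\mathbb{R}^{b_k}$ and $1\le i\le k-2$ (unmentioned entries unchanged): $cyc^k(\overline{c})$ has entry $1$ equal to $\max(c_1,c_{b_k}-1)$, entry $b_k$ equal to $\min(c_1+1,c_{b_k})$; $dec^k_i(\overline{c})$ has entry $i$ equal to $\min(c_i,c_{b_k-i+1}+h_i)$, entry $b_k-i+1$ equal to $\max(c_i-h_i,c_{b_k-i+1})$; $mov^k_i(\overline{c})$ has entry $t$ equal to $\min(c_t,c_{t+1})$ for $t\in\{i,b_k-i\}$ and $\max(c_{t-1},c_t)$ for $t\in\{i+1,b_k-i+1\}$. $args(cyc^k)=\{1,b_k\}$, $args(dec^k_i)=\{i,b_k-i+1\}$, $args(mov^k_i)=\{i,i+1,b_k-i,b_k-i+1\}$. With $i\in\{1,\dots,k-2\}$: $Q^k_1=\{cyc^k\}\cup\{dec^k_i:i\equiv2\}\cup\{mov^k_i:i\equiv0\}$, $Q^k_2=\{dec^k_i:i\equiv1\}\cup\{mov^k_i:i\equiv2\}$, $Q^k_3=\{dec^k_i:i\equiv0\}\cup\{mov^k_i:i\equiv1\}$ (mod 3). Within each $Q^k_r$ the sets $args(f)$ are pairwise disjoint, and $Q^k_r(\overline{c})$ denotes the sequence with entry $t$ equal to $(f(\overline{c}))_t$ if $t\in args(f)$ for some $f\in Q^k_r$ and $c_t$ otherwise. -}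

module Defs where

open import Data.Bool using (Bool; true; false; _∧_; _∨_; if_then_else_)
open import Data.Nat using (ℕ; zero; suc; _+_; _*_; _∸_; _^_; _%_; _≡ᵇ_)
open import Data.Integer as ℤ using (ℤ; +_; _⊓_; _⊔_)
open import Data.List using (List; []; _∷_; map; upTo; concat; concatMap; _++_; replicate; foldl)
open import Data.Bool.ListAction using (any)
open import Data.Vec using (Vec; tabulate; toList)
open import Data.Fin using (toℕ)
open import Data.Product using (_×_; _,_; ∃₂)
open import Relation.Binary.PropositionalEquality using (_≡_)

n : ℕ → ℕ
n k = 2 ^ (k ∸ 1) ∸ 1

b : ℕ → ℕ
b k = 2 * (k ∸ 2)

N : ℕ → ℕ
N k = n k * b k

h : ℕ → ℕ → ℕ
h k i = 2 ^ (k ∸ i ∸ 1) ∸ 1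

oneTo : ℕ → List ℕ
oneTo m = map suc (upTo m)

≡₃ : ℕ → ℕ → Bool
≡₃ m r = (m % 3) ≡ᵇ (r % 3)

-- 0-based access into a list, default false (never used out of range)
atL : List Bool → ℕ → Bool
atL []       _       = false
atL (x ∷ _)  zero    = x
atL (_ ∷ xs) (suc p) = atL xs p

-- 1-based register access: reg x p = x_p  (for 1 ≤ p ≤ length)
reg : ∀ {m} → Vec Bool m → ℕ → Bool
reg x zero    = false
reg x (suc p) = atL (toList x) p

colWord : (k : ℕ) → Vec Bool (N k) → ℕ → List Bool
colWord k x j = map (λ i → reg x (j + i * b k)) (upTo (n k))

ones : List Bool → ℕ
ones []           = 0
ones (true ∷ w)   = suc (ones w)
ones (false ∷ w)  = ones w

Sorted01 : List Bool → Set
Sorted01 w = ∃₂ λ a c → w ≡ replicate a false ++ replicate c true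

Comparator : Set
Comparator = ℕ × ℕ   -- (a , b) stands for [a:b]

S1 : ℕ → List Comparator
S1 k = map (λ i → (b k * i , b k * i + 1)) (oneTo (n k ∸ 1))

S2 : ℕ → ℕ → List Comparator
S2 k j = map (λ i → (b k * i + j , b k * ((i + 2 ^ (k ∸ j ∸ 1)) ∸ 1) + (b k ∸ j) + 1))
             (upTo (suc (n k ∸ 2 ^ (k ∸ j ∸ 1))))

S3 : ℕ → ℕ → List Comparator
S3 k j = concatMap (λ i → (b k * i + j , b k * i + j + 1)
                        ∷ (b k * i + (b k ∸ j) , b k * i + (b k ∸ j) + 1) ∷ [])
                   (upTo (n k))

-- T^k_r = ⋃ { S_{k,m} : 1 ≤ m ≤ 2k-3, m ≡ r (mod 3) }
Tlist : ℕ → ℕ → List Comparator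
Tlist k r =
  (if ≡₃ 1 r then S1 k else [])
  ++ concatMap (λ j → (if ≡₃ (2 * j) r then S2 k j else [])
                      ++ (if ≡₃ (2 * j + 1) r then S3 k j else []))
               (oneTo (k ∸ 2))

applyComp : (ℕ → Bool) → Comparator → (ℕ → Bool)
applyComp f (a , c) p =
  if p ≡ᵇ a then f a ∧ f c
  else if p ≡ᵇ c then f a ∨ f c
  else f p

-- T^k_r(x): apply all comparators of T^k_r (they act on disjoint pairs,
-- so applying them one after another equals applying them simultaneously)
T : (k r : ℕ) → Vec Bool (N k) → Vec Bool (N k)
T k r x = tabulate (λ p → foldl applyComp (reg x) (Tlist k r) (suc (toℕ p)))

-- 1-based entry of an integer vector (default 0, never used out of range)
atZ : List ℤ → ℕ → ℤ
atZ []       _       = + 0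
atZ (x ∷ _)  zero    = x
atZ (_ ∷ xs) (suc p) = atZ xs p

entry : ∀ {m} → Vec ℤ m → ℕ → ℤ
entry v zero    = + 0
entry v (suc t) = atZ (toList v) t

colCounts : (k : ℕ) → Vec Bool (N k) → Vec ℤ (b k)
colCounts k x = tabulate (λ t → + ones (colWord k x (suc (toℕ t))))

-- an operation f together with args(f); f c t is only consulted for t ∈ args(f)
record Op : Set where
  constructor op
  field
    fun  : (ℕ → ℤ) → ℕ → ℤ
    args : List ℕ

cyc : ℕ → Op
cyc k = op (λ c t → if t ≡ᵇ 1 then c 1 ⊔ (c (b k) ℤ.- + 1)
                    else if t ≡ᵇ b k then (c 1 ℤ.+ + 1) ⊓ c (b k)
                    else c t)
           (1 ∷ b k ∷ [])

dec : ℕ → ℕ → Op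
dec k i = op (λ c t → if t ≡ᵇ i then c i ⊓ (c (b k ∸ i + 1) ℤ.+ + h k i)
                      else if t ≡ᵇ (b k ∸ i + 1) then (c i ℤ.- + h k i) ⊔ c (b k ∸ i + 1)
                      else c t)
             (i ∷ (b k ∸ i + 1) ∷ [])

mov : ℕ → ℕ → Op
mov k i = op (λ c t → if (t ≡ᵇ i) ∨ (t ≡ᵇ (b k ∸ i)) then c t ⊓ c (t + 1)
                      else if (t ≡ᵇ (i + 1)) ∨ (t ≡ᵇ (b k ∸ i + 1)) then c (t ∸ 1) ⊔ c t
                      else c t)
             (i ∷ (i + 1) ∷ (b k ∸ i) ∷ (b k ∸ i + 1) ∷ [])

idxs : ℕ → ℕ → List ℕ
idxs k s = concatMap (λ i → if ≡₃ i s then i ∷ [] else []) (oneTo (k ∸ 2))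

Qops : ℕ → ℕ → List Op
Qops k 1 = cyc k ∷ map (dec k) (idxs k 2) ++ map (mov k) (idxs k 0)
Qops k 2 = map (dec k) (idxs k 1) ++ map (mov k) (idxs k 2)
Qops k 3 = map (dec k) (idxs k 0) ++ map (mov k) (idxs k 1)
Qops k _ = []

applyQ : List Op → (ℕ → ℤ) → ℕ → ℤ
applyQ []              c t = c t
applyQ (op f as ∷ fs)  c t = if any (λ s → s ≡ᵇ t) as then f c t else applyQ fs c t

Q : (k r : ℕ) → Vec ℤ (b k) → Vec ℤ (b k)
Q k r v = tabulate (λ t → applyQ (Qops k r) (entry v) (suc (toℕ t)))

-- Register b·i + t holds row i of column t, and every comparator of T^k_r joins row i of a column
-- u to row i + s of a column u′ (s = 1 for S_1, h_j for S_{2j}, 0 for S_{2j+1}).  Which layer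
-- touches a column t is decided by the residue of r mod 3: among S_{2m-1}, S_{2m}, S_{2m+1}, with
-- m the column among t and b + 1 - t that lies in [1, k - 2], exactly one belongs to T^k_r.  Hence
-- the column of each register and its role (partner column, shift, lower or upper end) are the same
-- in every row, and since the role of a column determines its comparators, these are pairwise
-- disjoint.  A layer therefore replaces column u by the rowwise minimum of u and u′ shifted by s, and
-- u′ by the rowwise maximum.  For sorted columns with c_u and c_u′ ones the results are sorted, with
-- min(c_u, c_u′ + s) and max(c_u - s, c_u′) ones: exactly cyc, dec_j and mov_j, and the residues
-- defining Q^k_r select the operations of the layers of T^k_r.

module Submission where

open import Data.Bool using (Bool; true; false; _∧_; _∨_; if_then_else_)
open import Data.Bool.ListAction using (any)
open import Data.Bool.Properties using (∧-identityʳ; ∨-zeroʳ; T-≡)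
open import Data.Empty using (⊥-elim)
open import Data.Fin using (toℕ)
open import Data.Fin.Properties using (toℕ<n)
open import Data.Integer as ℤ using (ℤ; +_)
import Data.Integer.Properties as ℤ
open import Data.List using (List; []; _∷_; foldl; map; upTo; applyUpTo; replicate; _++_; length; concatMap)
open import Data.List.Properties using (map-upTo; length-map; length-upTo; length-++; length-replicate; map-cong-local)
open import Data.List.Membership.Propositional using (_∈_)
open import Data.List.Membership.Propositional.Properties
  using (∈-upTo⁺; ∈-upTo⁻; ∈-map⁺; ∈-map⁻; ∈-concat⁺′; ∈-concat⁻′; ∈-++⁺ˡ; ∈-++⁺ʳ; ∈-++⁻)
import Data.List.Relation.Unary.All as All
open import Data.List.Relation.Unary.Any as Any using (here; there)
open import Data.List.Relation.Unary.Any.Properties using (any⁺; any⁻)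
open import Data.Nat
  using (ℕ; zero; suc; _+_; _*_; _∸_; _^_; _%_; _⊓_; _⊔_; _≤_; _<_; _≡ᵇ_; _≤ᵇ_; _≟_; _≤?_; z≤n; s≤s; s≤s⁻¹; z<s)
open import Data.Nat.DivMod using ([m+n]%n≡m%n; m%n<n)
open import Data.Nat.Properties
open import Data.Nat.Tactic.RingSolver using (solve-∀)
open import Data.Product using (_×_; _,_; proj₁; proj₂; ∃)
open import Data.Product.Properties using (≡-dec)
open import Data.List.Membership.DecPropositional (≡-dec _≟_ _≟_) using (_∈?_)
open import Data.Sum using (_⊎_; inj₁; inj₂)
open import Data.Vec using (Vec; tabulate; toList)
open import Data.Vec.Properties using (tabulate-cong)
open import Function using (_∘_)
open import Function.Bundles using (Equivalence)
open import Relation.Binary.Definitions using (tri<; tri≈; tri>)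
open import Relation.Binary.PropositionalEquality
open import Relation.Nullary using (Dec; yes; no; contradiction)
open import Relation.Nullary.Decidable using (dec-true; dec-false)

open import Defs

≡ᵇ-refl : ∀ m → (m ≡ᵇ m) ≡ true
≡ᵇ-refl m = dec-true (m ≟ m) refl

≢⇒≡ᵇ-false : ∀ {m n} → m ≢ n → (m ≡ᵇ n) ≡ false
≢⇒≡ᵇ-false {m} {n} = dec-false (m ≟ n)

m+1≢m : ∀ m → m + 1 ≢ m
m+1≢m m = 1+n≢n ∘ trans (+-comm 1 m)

if-true : ∀ {A : Set} {c} {x y : A} → c ≡ true → (if c then x else y) ≡ x
if-true refl = refl

if-false : ∀ {A : Set} {c} {x y : A} → c ≡ false → (if c then x else y) ≡ y
if-false refl = refl

-- Residues modulo 3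

≡₃-periodic : ∀ m r → ≡₃ (3 + m) r ≡ ≡₃ m r
≡₃-periodic m r = cong (_≡ᵇ r % 3) (trans (cong (_% 3) (+-comm 3 m)) ([m+n]%n≡m%n m 3))

data OneHot : Bool → Bool → Bool → Set where
  first  : OneHot true false false
  second : OneHot false true false
  third  : OneHot false false true

oneHot-rotate : ∀ {x y z} → OneHot x y z → OneHot y z x
oneHot-rotate first  = third
oneHot-rotate second = first
oneHot-rotate third  = second

oneHot-exclusive : ∀ {x y z} → OneHot x y z → x ≡ true → y ≡ false × z ≡ false
oneHot-exclusive first  _ = refl , refl
oneHot-exclusive second ()
oneHot-exclusive third  ()

oneHot-exhaustive : ∀ {x y z} → OneHot x y z → y ≡ false → z ≡ false → x ≡ true
oneHot-exhaustive first  _  _ = refl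
oneHot-exhaustive second () _
oneHot-exhaustive third  _  ()

oneHot-base : ∀ ρ → ρ < 3 → OneHot (0 ≡ᵇ ρ) (1 ≡ᵇ ρ) (2 ≡ᵇ ρ)
oneHot-base 0 _ = first
oneHot-base 1 _ = second
oneHot-base 2 _ = third
oneHot-base (suc (suc (suc _))) (s≤s (s≤s (s≤s ())))

≡₃-oneHot : ∀ r m → OneHot (≡₃ m r) (≡₃ (1 + m) r) (≡₃ (2 + m) r)
≡₃-oneHot r zero    = oneHot-base (r % 3) (m%n<n r 3)
≡₃-oneHot r (suc m) = subst (OneHot _ _) (sym (≡₃-periodic m r)) (oneHot-rotate (≡₃-oneHot r m))

≡₃-next : ∀ m r → ≡₃ m r ≡ true → ≡₃ (1 + m) r ≡ false × ≡₃ (2 + m) r ≡ false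
≡₃-next m r = oneHot-exclusive (≡₃-oneHot r m)

≡₃-prev : ∀ m r → ≡₃ (1 + m) r ≡ true → ≡₃ m r ≡ false
≡₃-prev m r e with ≡₃ m r in eq
... | false = refl
... | true  = trans (sym e) (proj₁ (≡₃-next m r eq))

≡₃-one-of-three : ∀ m r → ≡₃ (1 + m) r ≡ false → ≡₃ (2 + m) r ≡ false → ≡₃ m r ≡ true
≡₃-one-of-three m r = oneHot-exhaustive (≡₃-oneHot r m)

-- Sequential application of comparators

Avoids : Comparator → ℕ → Set
Avoids (a , c) p = a ≢ p × c ≢ p

applyComp-avoiding : ∀ f {d p} → Avoids d p → applyComp f d p ≡ f p
applyComp-avoiding f {a , c} {p} (a≢p , c≢p)
  rewrite ≢⇒≡ᵇ-false (a≢p ∘ sym) | ≢⇒≡ᵇ-false (c≢p ∘ sym) = refl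

foldl-applyComp-avoiding : ∀ L f {p} → (∀ {d} → d ∈ L → Avoids d p) →
                           foldl applyComp f L p ≡ f p
foldl-applyComp-avoiding []      f avoid = refl
foldl-applyComp-avoiding (d ∷ L) f avoid =
  trans (foldl-applyComp-avoiding L (applyComp f d) (avoid ∘ there))
        (applyComp-avoiding f (avoid (here refl)))

Isolated : List Comparator → ℕ → ℕ → Set
Isolated L a c = ∀ {d} → d ∈ L → d ≡ (a , c) ⊎ (Avoids d a × Avoids d c)

SortsPair : (ℕ → Bool) → (ℕ → Bool) → ℕ → ℕ → Set
SortsPair f g a c = g a ≡ f a ∧ f c × g c ≡ f a ∨ f c

applyComp-sorts : ∀ f {a c} → a ≢ c → SortsPair f (applyComp f (a , c)) a c
applyComp-sorts f {a} {c} a≢c rewrite ≡ᵇ-refl a | ≢⇒≡ᵇ-false (a≢c ∘ sym) | ≡ᵇ-refl c = refl , refl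

sortsPair-trans : ∀ {f g h : ℕ → Bool} {a c} → SortsPair f g a c → SortsPair g h a c → SortsPair f h a c
sortsPair-trans {f} {a = a} {c} (ga , gc) (ha , hc) =
  trans ha (trans (cong₂ _∧_ ga gc) (min-of-sorted (f a) (f c))) ,
  trans hc (trans (cong₂ _∨_ ga gc) (max-of-sorted (f a) (f c)))
  where
  min-of-sorted : ∀ x y → (x ∧ y) ∧ (x ∨ y) ≡ x ∧ y
  min-of-sorted true  true  = refl
  min-of-sorted true  false = refl
  min-of-sorted false _     = refl
  max-of-sorted : ∀ x y → (x ∧ y) ∨ (x ∨ y) ≡ x ∨ y
  max-of-sorted true  true  = refl
  max-of-sorted true  false = refl
  max-of-sorted false _     = refl

foldl-applyComp-isolated : ∀ {a c} → a ≢ c → ∀ L f → Isolated L a c → (a , c) ∈ L →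
                           SortsPair f (foldl applyComp f L) a c
foldl-applyComp-isolated a≢c (d ∷ L) f iso mem with iso (here refl)
... | inj₁ refl with d ∈? L
...   | yes d∈L = sortsPair-trans {f} {applyComp f d} {foldl applyComp (applyComp f d) L} (applyComp-sorts f a≢c)
                    (foldl-applyComp-isolated a≢c L (applyComp f d) (iso ∘ there) d∈L)
...   | no  d∉L = trans (foldl-applyComp-avoiding L _ (proj₁ ∘ avoidsBoth)) (proj₁ sorted) ,
                  trans (foldl-applyComp-avoiding L _ (proj₂ ∘ avoidsBoth)) (proj₂ sorted)
  where
  sorted = applyComp-sorts f a≢c
  avoidsBoth : ∀ {e} → e ∈ L → Avoids e (proj₁ d) × Avoids e (proj₂ d)
  avoidsBoth e∈L with iso (there e∈L)
  ... | inj₁ refl = ⊥-elim (d∉L e∈L)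
  ... | inj₂ avoids = avoids
foldl-applyComp-isolated a≢c (d ∷ L) f iso (here refl) | inj₂ ((a≢a , _) , _) = ⊥-elim (a≢a refl)
foldl-applyComp-isolated a≢c (d ∷ L) f iso (there mem) | inj₂ (avoid-a , avoid-c) =
  let (ga , gc) = foldl-applyComp-isolated a≢c L (applyComp f d) (iso ∘ there) mem
      fa = applyComp-avoiding f avoid-a
      fc = applyComp-avoiding f avoid-c
  in trans ga (cong₂ _∧_ fa fc) , trans gc (cong₂ _∨_ fa fc)

-- Sorted 0-1 words

stepBit : ℕ → ℕ → Bool
stepBit zero    _       = true
stepBit (suc a) zero    = false
stepBit (suc a) (suc i) = stepBit a i

stepBit-≤ : ∀ {a i} → a ≤ i → stepBit a i ≡ true
stepBit-≤ z≤n       = refl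
stepBit-≤ (s≤s a≤i) = stepBit-≤ a≤i

stepBit-> : ∀ {a i} → i < a → stepBit a i ≡ false
stepBit-> {suc a} {zero}  _         = refl
stepBit-> {suc a} {suc i} (s≤s i<a) = stepBit-> i<a

stepBit-⊔ : ∀ a a′ i → stepBit (a ⊔ a′) i ≡ stepBit a i ∧ stepBit a′ i
stepBit-⊔ zero    a′       i       = refl
stepBit-⊔ (suc a) zero     i       = sym (∧-identityʳ _)
stepBit-⊔ (suc a) (suc a′) zero    = refl
stepBit-⊔ (suc a) (suc a′) (suc i) = stepBit-⊔ a a′ i

stepBit-⊓ : ∀ a a′ i → stepBit (a ⊓ a′) i ≡ stepBit a i ∨ stepBit a′ i
stepBit-⊓ zero    a′       i       = refl
stepBit-⊓ (suc a) zero     i       = sym (∨-zeroʳ _)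
stepBit-⊓ (suc a) (suc a′) zero    = refl
stepBit-⊓ (suc a) (suc a′) (suc i) = stepBit-⊓ a a′ i

stepBit-∸ : ∀ a s i → stepBit (a ∸ s) i ≡ stepBit a (i + s)
stepBit-∸ a       zero    i = cong (stepBit a) (sym (+-identityʳ i))
stepBit-∸ zero    (suc s) i = refl
stepBit-∸ (suc a) (suc s) i = trans (stepBit-∸ a s i) (cong (stepBit (suc a)) (sym (+-suc i s)))

stepBit-+ : ∀ a s i → stepBit (a + s) (i + s) ≡ stepBit a i
stepBit-+ a zero    i = cong₂ stepBit (+-identityʳ a) (+-identityʳ i)
stepBit-+ a (suc s) i = trans (cong₂ stepBit (+-suc a s) (+-suc i s)) (stepBit-+ a s i)

ones-stepBits : ∀ a m → ones (map (stepBit a) (upTo m)) ≡ m ∸ a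
ones-stepBits a m = trans (cong ones (map-upTo (stepBit a) m)) (go a m)
  where
  go : ∀ a m → ones (applyUpTo (stepBit a) m) ≡ m ∸ a
  go a       zero    = sym (0∸n≡0 a)
  go zero    (suc m) = cong suc (go zero m)
  go (suc a) (suc m) = go a m

ones≤length : ∀ w → ones w ≤ length w
ones≤length []          = z≤n
ones≤length (true ∷ w)  = s≤s (ones≤length w)
ones≤length (false ∷ w) = m≤n⇒m≤1+n (ones≤length w)

ones-0ᵃ1ᶜ : ∀ a c → ones (replicate a false ++ replicate c true) ≡ c
ones-0ᵃ1ᶜ zero    zero    = refl
ones-0ᵃ1ᶜ zero    (suc c) = cong suc (ones-0ᵃ1ᶜ zero c)
ones-0ᵃ1ᶜ (suc a) c       = ones-0ᵃ1ᶜ a c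

atL-0ᵃ1ᶜ : ∀ a c {i} → i < a + c → atL (replicate a false ++ replicate c true) i ≡ stepBit a i
atL-0ᵃ1ᶜ zero    (suc c) {zero}  _         = refl
atL-0ᵃ1ᶜ zero    (suc c) {suc i} (s≤s i<c) = atL-0ᵃ1ᶜ zero c i<c
atL-0ᵃ1ᶜ (suc a) c       {zero}  _         = refl
atL-0ᵃ1ᶜ (suc a) c       {suc i} (s≤s i<n) = atL-0ᵃ1ᶜ a c i<n

atL-sorted : ∀ {w} → Sorted01 w → ∀ {i} → i < length w → atL w i ≡ stepBit (length w ∸ ones w) i
atL-sorted (a , c , refl) {i} i<len
  rewrite length-++ (replicate a false) {replicate c true} | length-replicate a {false}
        | length-replicate c {true} | ones-0ᵃ1ᶜ a c | m+n∸n≡m a c = atL-0ᵃ1ᶜ a c i<len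

atL-map-upTo : ∀ g m {i} → i < m → atL (map g (upTo m)) i ≡ g i
atL-map-upTo g m i<m = trans (cong (λ w → atL w _) (map-upTo g m)) (go g m i<m)
  where
  go : ∀ g m {i} → i < m → atL (applyUpTo g m) i ≡ g i
  go g (suc m) {zero}  _         = refl
  go g (suc m) {suc i} (s≤s i<m) = go (g ∘ suc) m i<m

length-map-upTo : ∀ (g : ℕ → Bool) m → length (map g (upTo m)) ≡ m
length-map-upTo g m = trans (length-map g (upTo m)) (length-upTo m)

map-cong-upTo : ∀ {g g′ : ℕ → Bool} m → (∀ {i} → i < m → g i ≡ g′ i) → map g (upTo m) ≡ map g′ (upTo m)
map-cong-upTo m eq = map-cong-local (All.tabulate (eq ∘ ∈-upTo⁻))

-- A sorted column of length m with c ones has m ∸ c zeros.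

ones-min-shifted : ∀ m c c′ s → c ≤ m → c′ ≤ m →
                   + (m ∸ ((m ∸ c) ⊔ ((m ∸ c′) ∸ s))) ≡ + c ℤ.⊓ (+ c′ ℤ.+ + s)
ones-min-shifted m c c′ s c≤m c′≤m = cong +_ (begin
  m ∸ ((m ∸ c) ⊔ ((m ∸ c′) ∸ s))         ≡⟨ ∸-distribˡ-⊔-⊓ m (m ∸ c) ((m ∸ c′) ∸ s) ⟩
  (m ∸ (m ∸ c)) ⊓ (m ∸ ((m ∸ c′) ∸ s))   ≡⟨ cong₂ _⊓_ (m∸[m∸n]≡n c≤m) (cong (m ∸_) (∸-+-assoc m c′ s)) ⟩
  c ⊓ (m ∸ (m ∸ (c′ + s)))               ≡⟨ cong (c ⊓_) (m∸[m∸n]≡m⊓n m (c′ + s)) ⟩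
  c ⊓ (m ⊓ (c′ + s))                     ≡⟨ ⊓-assoc c m (c′ + s) ⟨
  (c ⊓ m) ⊓ (c′ + s)                     ≡⟨ cong (_⊓ (c′ + s)) (m≤n⇒m⊓n≡m c≤m) ⟩
  c ⊓ (c′ + s)                           ∎)
  where
  open ≡-Reasoning
  m∸[m∸n]≡m⊓n : ∀ m n → m ∸ (m ∸ n) ≡ m ⊓ n
  m∸[m∸n]≡m⊓n m n with ≤-total n m
  ... | inj₁ n≤m = trans (m∸[m∸n]≡n n≤m) (sym (m≥n⇒m⊓n≡n n≤m))
  ... | inj₂ m≤n = trans (cong (m ∸_) (m≤n⇒m∸n≡0 m≤n)) (sym (m≤n⇒m⊓n≡m m≤n))

ones-max-shifted : ∀ m c c′ s → c ≤ m → c′ ≤ m →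
                   + (m ∸ (((m ∸ c) + s) ⊓ (m ∸ c′))) ≡ (+ c ℤ.- + s) ℤ.⊔ + c′
ones-max-shifted m c c′ s c≤m c′≤m = trans (cong +_ counts) (truncated-difference (≤-total s c))
  where
  open ≡-Reasoning
  counts : m ∸ (((m ∸ c) + s) ⊓ (m ∸ c′)) ≡ (c ∸ s) ⊔ c′
  counts = begin
    m ∸ (((m ∸ c) + s) ⊓ (m ∸ c′))         ≡⟨ ∸-distribˡ-⊓-⊔ m ((m ∸ c) + s) (m ∸ c′) ⟩
    (m ∸ ((m ∸ c) + s)) ⊔ (m ∸ (m ∸ c′))   ≡⟨ cong₂ _⊔_ (sym (∸-+-assoc m (m ∸ c) s)) (m∸[m∸n]≡n c′≤m) ⟩
    ((m ∸ (m ∸ c)) ∸ s) ⊔ c′               ≡⟨ cong (λ z → (z ∸ s) ⊔ c′) (m∸[m∸n]≡n c≤m) ⟩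
    (c ∸ s) ⊔ c′                           ∎
  truncated-difference : s ≤ c ⊎ c ≤ s → + ((c ∸ s) ⊔ c′) ≡ (+ c ℤ.- + s) ℤ.⊔ + c′
  truncated-difference (inj₁ s≤c) =
    cong (ℤ._⊔ + c′) (sym (trans (ℤ.[+m]-[+n]≡m⊖n c s) (ℤ.⊖-≥ s≤c)))
  truncated-difference (inj₂ c≤s) rewrite m≤n⇒m∸n≡0 c≤s =
    sym (ℤ.i≤j⇒i⊔j≡j (ℤ.≤-trans (ℤ.≤-reflexive (trans (ℤ.[+m]-[+n]≡m⊖n c s) (ℤ.⊖-≤ c≤s))) ℤ.neg-≤-pos))

∸-suc-+1 : ∀ {B j} → suc j ≤ B → B ∸ suc j + 1 ≡ B ∸ j
∸-suc-+1 {suc B} {j} (s≤s j≤B) = sym (trans (cong (_∸ j) (+-comm 1 B)) (+-∸-comm 1 j≤B))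

mirror-involutive : ∀ {B j} → 1 ≤ j → j ≤ B → B ∸ (B ∸ j + 1) + 1 ≡ j
mirror-involutive {B} {suc j} _ j<B = begin
  B ∸ (B ∸ suc j + 1) + 1 ≡⟨ cong (λ z → B ∸ z + 1) (∸-suc-+1 j<B) ⟩
  B ∸ (B ∸ j) + 1         ≡⟨ cong (_+ 1) (m∸[m∸n]≡n (<⇒≤ j<B)) ⟩
  j + 1                   ≡⟨ +-comm j 1 ⟩
  suc j                   ∎
  where open ≡-Reasoning

mirror-≤ : ∀ {B j} → 1 ≤ j → j ≤ B → B ∸ j + 1 ≤ B
mirror-≤ {B} {suc j} _ j<B = subst (_≤ B) (sym (∸-suc-+1 j<B)) (m∸n≤m B j)

1≤mirror : ∀ B j → 1 ≤ B ∸ j + 1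
1≤mirror B j = m≤n+m 1 (B ∸ j)

2*K∸K≡K : ∀ K → 2 * K ∸ K ≡ K
2*K∸K≡K K = trans (cong (λ z → K + z ∸ K) (+-identityʳ K)) (m+n∸m≡n K K)

mirror-left-half : ∀ {K j} → j ≤ K → K < 2 * K ∸ j + 1
mirror-left-half {K} {j} j≤K = subst (K <_) (+-comm 1 (2 * K ∸ j))
  (s≤s (subst (_≤ 2 * K ∸ j) (2*K∸K≡K K) (∸-monoʳ-≤ (2 * K) j≤K)))

mirror-right-half : ∀ {K t} → K < t → t ≤ 2 * K → 2 * K ∸ t + 1 ≤ K
mirror-right-half {K} {t} K<t t≤2K = subst₂ _≤_ (+-comm 1 (2 * K ∸ t)) (2*K∸K≡K K) (∸-monoʳ-< K<t t≤2K)

K<2*K : ∀ {K} → 1 ≤ K → K < 2 * K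
K<2*K {K} 1≤K = subst (K <_) (cong (λ z → K + z) (sym (+-identityʳ K))) (m<m+n K 1≤K)

mirror-parity : ∀ {K j} → j ≤ K → j + 1 ≢ 2 * K ∸ j
mirror-parity {K} {j} j≤K eq = even≢odd K j (begin
  2 * K            ≡⟨ m∸n+n≡m (≤-trans j≤K (m≤m+n K (K + 0))) ⟨
  2 * K ∸ j + j    ≡⟨ cong (_+ j) eq ⟨
  j + 1 + j        ≡⟨ shape j ⟩
  suc (2 * j)      ∎)
  where
  open ≡-Reasoning
  shape : ∀ j → j + 1 + j ≡ suc (2 * j)
  shape = solve-∀

K≤b : ∀ k → k ∸ 2 ≤ b k
K≤b k = m≤m+n (k ∸ 2) (k ∸ 2 + 0)

-- Roles of the columns in the layer T^k_r

-- minWith u s: row i becomes the minimum of itself and row i + s of column u;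
-- maxWith u s: row i becomes the maximum of itself and row i ∸ s of column u.
data Role : Set where
  minWith maxWith : ℕ → ℕ → Role

roleLeft : ℕ → ℕ → ℕ → Role
roleLeft k r t =
  if ≡₃ (2 * t) r then minWith (b k ∸ t + 1) (h k t)
  else if ≡₃ (2 * t + 1) r then minWith (t + 1) 0
  else if t ≡ᵇ 1 then maxWith (b k) 1
  else maxWith (t ∸ 1) 0

roleRight : ℕ → ℕ → ℕ → ℕ → Role
roleRight k r m t =
  if ≡₃ (2 * m) r then maxWith m (h k m)
  else if ≡₃ (2 * m + 1) r then maxWith (t ∸ 1) 0
  else if m ≡ᵇ 1 then minWith 1 1
  else minWith (t + 1) 0

-- Read off the layer among S_{2m-1}, S_{2m}, S_{2m+1} that lies in T^k_r, where m = t on the left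
-- half and m = b ∸ t + 1 on the right half.
role : ℕ → ℕ → ℕ → Role
role k r t = if t ≤ᵇ (k ∸ 2) then roleLeft k r t else roleRight k r (b k ∸ t + 1) t

role-left : ∀ k r {t} → t ≤ k ∸ 2 → role k r t ≡ roleLeft k r t
role-left k r {t} t≤K = if-true (dec-true (t ≤? k ∸ 2) t≤K)

role-right : ∀ k r {t} → k ∸ 2 < t → role k r t ≡ roleRight k r (b k ∸ t + 1) t
role-right k r {t} K<t = if-false (dec-false (t ≤? k ∸ 2) (<⇒≱ K<t))

module _ (k r : ℕ) (1≤K : 1 ≤ k ∸ 2) where
  private
    K = k ∸ 2

  role-mirror : ∀ {j} → 1 ≤ j → j ≤ K → role k r (b k ∸ j + 1) ≡ roleRight k r j (b k ∸ j + 1)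
  role-mirror {j} 1≤j j≤K = trans (role-right k r (mirror-left-half j≤K))
    (cong (λ m → roleRight k r m (b k ∸ j + 1)) (mirror-involutive 1≤j (≤-trans j≤K (K≤b k))))

  role-first : ≡₃ 1 r ≡ true → role k r 1 ≡ maxWith (b k) 1
  role-first cyc∈T = let (¬S₂ , ¬S₃) = ≡₃-next 1 r cyc∈T in
    trans (role-left k r 1≤K) (trans (if-false ¬S₂) (if-false ¬S₃))

  role-last : ≡₃ 1 r ≡ true → role k r (b k) ≡ minWith 1 1
  role-last cyc∈T = let (¬S₂ , ¬S₃) = ≡₃-next 1 r cyc∈T in
    trans (role-right k r (K<2*K 1≤K))
      (trans (cong (λ m → roleRight k r m (b k)) (cong (_+ 1) (n∸n≡0 (b k))))
        (trans (if-false ¬S₂) (if-false ¬S₃)))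

  module _ {j} (1≤j : 1 ≤ j) (j≤K : j ≤ K) where

    role-dec-left : ≡₃ (2 * j) r ≡ true → role k r j ≡ minWith (b k ∸ j + 1) (h k j)
    role-dec-left dec∈T = trans (role-left k r j≤K) (if-true dec∈T)

    role-dec-right : ≡₃ (2 * j) r ≡ true → role k r (b k ∸ j + 1) ≡ maxWith j (h k j)
    role-dec-right dec∈T = trans (role-mirror 1≤j j≤K) (if-true dec∈T)

    module _ (mov∈T : ≡₃ (2 * j + 1) r ≡ true) where
      private
        mov∈T′ : ≡₃ (1 + 2 * j) r ≡ true
        mov∈T′ = subst (λ m → ≡₃ m r ≡ true) (+-comm (2 * j) 1) mov∈T

        dec∉T : ≡₃ (2 * j) r ≡ false
        dec∉T = ≡₃-prev (2 * j) r mov∈T′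

        next∉T : ≡₃ (2 * (j + 1)) r ≡ false × ≡₃ (2 * (j + 1) + 1) r ≡ false
        next∉T = let (¬S₁ , ¬S₂) = ≡₃-next (1 + 2 * j) r mov∈T′ in
          subst (λ m → ≡₃ m r ≡ false) (shape₁ j) ¬S₁ , subst (λ m → ≡₃ m r ≡ false) (shape₂ j) ¬S₂
          where
          shape₁ : ∀ j → 1 + (1 + 2 * j) ≡ 2 * (j + 1)
          shape₁ = solve-∀
          shape₂ : ∀ j → 2 + (1 + 2 * j) ≡ 2 * (j + 1) + 1
          shape₂ = solve-∀

        j+1≢1 : (j + 1 ≡ᵇ 1) ≡ false
        j+1≢1 = ≢⇒≡ᵇ-false (λ eq → <⇒≢ (+-monoˡ-≤ 1 1≤j) (sym eq))

        b∸K≡K : b k ∸ K ≡ K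
        b∸K≡K = 2*K∸K≡K K

      role-mov-left : role k r j ≡ minWith (j + 1) 0
      role-mov-left = trans (role-left k r j≤K) (trans (if-false dec∉T) (if-true mov∈T))

      role-mov-left′ : role k r (j + 1) ≡ maxWith j 0
      role-mov-left′ with m≤n⇒m<n∨m≡n j≤K
      ... | inj₁ j<K = trans (role-left k r (subst (_≤ K) (+-comm 1 j) j<K))
                         (trans (if-false (proj₁ next∉T)) (trans (if-false (proj₂ next∉T))
                           (trans (if-false j+1≢1) (cong (λ i → maxWith i 0) (m+n∸n≡m j 1)))))
      ... | inj₂ refl = trans (role-right k r (m<m+n K z<s))
                          (trans (cong (λ m → roleRight k r m (K + 1)) mirror-K+1)
                            (trans (if-false dec∉T) (trans (if-true mov∈T) (cong (λ i → maxWith i 0) (m+n∸n≡m K 1)))))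
        where
        mirror-K+1 : b k ∸ (K + 1) + 1 ≡ K
        mirror-K+1 = trans (cong (λ z → b k ∸ z + 1) (+-comm K 1)) (trans (∸-suc-+1 (K<2*K 1≤K)) b∸K≡K)

      role-mov-right : role k r (b k ∸ j) ≡ minWith (b k ∸ j + 1) 0
      role-mov-right with m≤n⇒m<n∨m≡n j≤K
      ... | inj₁ j<K = trans (role-right k r K<b∸j)
                         (trans (cong (λ m → roleRight k r m (b k ∸ j)) mirror-b∸j)
                           (trans (if-false (proj₁ next∉T)) (trans (if-false (proj₂ next∉T)) (if-false j+1≢1))))
        where
        K<b∸j : K < b k ∸ j
        K<b∸j = subst (K <_) (∸-suc-+1 (≤-trans j<K (K≤b k))) (mirror-left-half j<K)
        mirror-b∸j : b k ∸ (b k ∸ j) + 1 ≡ j + 1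
        mirror-b∸j = cong (_+ 1) (m∸[m∸n]≡n (≤-trans j≤K (K≤b k)))
      ... | inj₂ refl rewrite b∸K≡K = role-mov-left

      role-mov-right′ : role k r (b k ∸ j + 1) ≡ maxWith (b k ∸ j) 0
      role-mov-right′ = trans (role-mirror 1≤j j≤K)
        (trans (if-false dec∉T) (trans (if-true mov∈T) (cong (λ i → maxWith i 0) (m+n∸n≡m (b k ∸ j) 1))))

-- The comparators of T^k_r

∈-if⁺ : ∀ {A : Set} {x : A} {c xs} → c ≡ true → x ∈ xs → x ∈ (if c then xs else [])
∈-if⁺ refl x∈xs = x∈xs

∈-if⁻ : ∀ {A : Set} {x : A} c {xs} → x ∈ (if c then xs else []) → c ≡ true × x ∈ xs
∈-if⁻ true x∈xs = refl , x∈xs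

∈-concatMap⁺ : ∀ {A B : Set} (f : A → List B) {x y xs} → y ∈ f x → x ∈ xs → y ∈ concatMap f xs
∈-concatMap⁺ f y∈fx x∈xs = ∈-concat⁺′ y∈fx (∈-map⁺ f x∈xs)

∈-concatMap⁻ : ∀ {A B : Set} (f : A → List B) xs {y} → y ∈ concatMap f xs → ∃ λ x → x ∈ xs × y ∈ f x
∈-concatMap⁻ f xs y∈ with ∈-concat⁻′ (map f xs) y∈
... | ys , y∈ys , ys∈ with ∈-map⁻ f ys∈
...   | x , x∈xs , refl = x , x∈xs , y∈ys

∈-oneTo⁺ : ∀ {i m} → i < m → suc i ∈ oneTo m
∈-oneTo⁺ i<m = ∈-map⁺ suc (∈-upTo⁺ i<m)

∈-oneTo⁻ : ∀ {j m} → j ∈ oneTo m → 1 ≤ j × j ≤ m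
∈-oneTo⁻ j∈ with ∈-map⁻ suc j∈
... | i , i∈ , refl = s≤s z≤n , ∈-upTo⁻ i∈

S1-comparator : ∀ k i → (b k * suc i , b k * suc i + 1) ≡ (b k * i + b k , b k * (i + 1) + 1)
S1-comparator k i = cong₂ _,_ (trans (*-suc (b k) i) (+-comm (b k) (b k * i)))
                               (cong (λ m → b k * m + 1) (+-comm 1 i))

∈-S1⁺ : ∀ {k i} → i + 1 < n k → (b k * i + b k , b k * (i + 1) + 1) ∈ S1 k
∈-S1⁺ {k} {i} i+1<n = subst (_∈ S1 k) (S1-comparator k i)
  (∈-map⁺ (λ i → (b k * i , b k * i + 1)) (∈-oneTo⁺ (m+n≤o⇒m≤o∸n (suc i) i+1<n)))

∈-S1⁻ : ∀ {k d} → d ∈ S1 k → ∃ λ i → i + 1 < n k × d ≡ (b k * i + b k , b k * (i + 1) + 1)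
∈-S1⁻ {k} d∈ with ∈-map⁻ (λ i → (b k * i , b k * i + 1)) d∈
... | _ , i∈ , refl with ∈-map⁻ suc i∈
...   | i , i<n∸1 , refl = i , m≤o∸n⇒m+n≤o (suc i) 1≤n (∈-upTo⁻ i<n∸1) , S1-comparator k i
  where
  1≤n : 1 ≤ n k
  1≤n = ≤-trans (s≤s z≤n) (≤-trans (∈-upTo⁻ i<n∸1) (m∸n≤m (n k) 1))

S2-comparator : ∀ k j i → 1 ≤ 2 ^ (k ∸ j ∸ 1) →
                b k * ((i + 2 ^ (k ∸ j ∸ 1)) ∸ 1) + (b k ∸ j) + 1 ≡ b k * (i + h k j) + (b k ∸ j + 1)
S2-comparator k j i 1≤P = trans (cong (λ m → b k * m + (b k ∸ j) + 1) (+-∸-assoc i 1≤P))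
                                (+-assoc (b k * (i + h k j)) (b k ∸ j) 1)

∸1<⇒≤ : ∀ {m o} → 1 ≤ m → m ∸ 1 < o → m ≤ o
∸1<⇒≤ {suc m} _ m<o = m<o

≤⇒∸1< : ∀ {m o} → 1 ≤ m → m ≤ o → m ∸ 1 < o
≤⇒∸1< {suc m} _ m≤o = m≤o

∈-S2⁺ : ∀ {k j i} → i + h k j < n k → (b k * i + j , b k * (i + h k j) + (b k ∸ j + 1)) ∈ S2 k j
∈-S2⁺ {k} {j} {i} i+h<n = subst (_∈ S2 k j) (cong (b k * i + j ,_) (S2-comparator k j i 1≤P))
  (∈-map⁺ (λ i → (b k * i + j , b k * ((i + 2 ^ (k ∸ j ∸ 1)) ∸ 1) + (b k ∸ j) + 1))
          (∈-upTo⁺ (s≤s (m+n≤o⇒m≤o∸n i i+P≤n))))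
  where
  1≤P = m^n>0 2 (k ∸ j ∸ 1)
  i+P≤n : i + 2 ^ (k ∸ j ∸ 1) ≤ n k
  i+P≤n = ∸1<⇒≤ (≤-trans 1≤P (m≤n+m _ i)) (subst (_< n k) (sym (+-∸-assoc i 1≤P)) i+h<n)

∈-S2⁻ : ∀ {k j d} → 2 ^ (k ∸ j ∸ 1) ≤ n k → d ∈ S2 k j →
        ∃ λ i → i + h k j < n k × d ≡ (b k * i + j , b k * (i + h k j) + (b k ∸ j + 1))
∈-S2⁻ {k} {j} P≤n d∈ with ∈-map⁻ (λ i → (b k * i + j , b k * ((i + 2 ^ (k ∸ j ∸ 1)) ∸ 1) + (b k ∸ j) + 1)) d∈
... | i , i∈ , refl = i , i+h<n , cong (b k * i + j ,_) (S2-comparator k j i 1≤P)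
  where
  i≤n∸P : i ≤ n k ∸ 2 ^ (k ∸ j ∸ 1)
  i≤n∸P = s≤s⁻¹ (∈-upTo⁻ i∈)
  1≤P = m^n>0 2 (k ∸ j ∸ 1)
  i+h<n : i + h k j < n k
  i+h<n = subst (_< n k) (+-∸-assoc i 1≤P) (≤⇒∸1< (≤-trans 1≤P (m≤n+m _ i)) (m≤o∸n⇒m+n≤o i P≤n i≤n∸P))

S3-comparator : ∀ k i u → (b k * i + u , b k * i + u + 1) ≡ (b k * i + u , b k * (i + 0) + (u + 1))
S3-comparator k i u = cong₂ _,_ refl
  (trans (+-assoc (b k * i) u 1) (cong (λ m → b k * m + (u + 1)) (sym (+-identityʳ i))))

S3-row : ℕ → ℕ → ℕ → List Comparator
S3-row k j i = (b k * i + j , b k * i + j + 1) ∷ (b k * i + (b k ∸ j) , b k * i + (b k ∸ j) + 1) ∷ []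

∈-S3⁺ : ∀ {k j i} → i + 0 < n k →
        (b k * i + j , b k * (i + 0) + (j + 1)) ∈ S3 k j ×
        (b k * i + (b k ∸ j) , b k * (i + 0) + (b k ∸ j + 1)) ∈ S3 k j
∈-S3⁺ {k} {j} {i} i<n =
  subst (_∈ S3 k j) (S3-comparator k i j) (∈-concatMap⁺ (S3-row k j) (here refl) i∈) ,
  subst (_∈ S3 k j) (S3-comparator k i (b k ∸ j)) (∈-concatMap⁺ (S3-row k j) (there (here refl)) i∈)
  where
  i∈ = ∈-upTo⁺ (subst (_< n k) (+-identityʳ i) i<n)

∈-S3⁻ : ∀ {k j d} → d ∈ S3 k j → ∃ λ i → i + 0 < n k ×
        (d ≡ (b k * i + j , b k * (i + 0) + (j + 1)) ⊎ d ≡ (b k * i + (b k ∸ j) , b k * (i + 0) + (b k ∸ j + 1)))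
∈-S3⁻ {k} {j} d∈ with ∈-concatMap⁻ (S3-row k j) (upTo (n k)) d∈
... | i , i∈ , here refl         = i , i+0<n , inj₁ (S3-comparator k i j)
  where i+0<n = subst (_< n k) (sym (+-identityʳ i)) (∈-upTo⁻ i∈)
... | i , i∈ , there (here refl) = i , i+0<n , inj₂ (S3-comparator k i (b k ∸ j))
  where i+0<n = subst (_< n k) (sym (+-identityʳ i)) (∈-upTo⁻ i∈)

layers : ℕ → ℕ → ℕ → List Comparator
layers k r j = (if ≡₃ (2 * j) r then S2 k j else []) ++ (if ≡₃ (2 * j + 1) r then S3 k j else [])

∈-T-S1 : ∀ {k r d} → ≡₃ 1 r ≡ true → d ∈ S1 k → d ∈ Tlist k r
∈-T-S1 cyc∈T d∈ = ∈-++⁺ˡ (∈-if⁺ cyc∈T d∈)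

∈-T-layers : ∀ {k r d j} → 1 ≤ j → j ≤ k ∸ 2 → d ∈ layers k r j → d ∈ Tlist k r
∈-T-layers {k} {r} {j = suc j} _ j<K d∈ =
  ∈-++⁺ʳ (if ≡₃ 1 r then S1 k else []) (∈-concatMap⁺ (layers k r) d∈ (∈-oneTo⁺ j<K))

∈-T-S2 : ∀ {k r d j} → 1 ≤ j → j ≤ k ∸ 2 → ≡₃ (2 * j) r ≡ true → d ∈ S2 k j → d ∈ Tlist k r
∈-T-S2 {k} {r} 1≤j j≤K dec∈T d∈ = ∈-T-layers {k} {r} 1≤j j≤K (∈-++⁺ˡ (∈-if⁺ dec∈T d∈))

∈-T-S3 : ∀ {k r d j} → 1 ≤ j → j ≤ k ∸ 2 → ≡₃ (2 * j + 1) r ≡ true → d ∈ S3 k j → d ∈ Tlist k r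
∈-T-S3 {k} {r} {j = j} 1≤j j≤K mov∈T d∈ =
  ∈-T-layers {k} {r} 1≤j j≤K (∈-++⁺ʳ (if ≡₃ (2 * j) r then S2 k j else []) (∈-if⁺ mov∈T d∈))

record Link (k r u u′ s : ℕ) : Set where
  field
    role-min     : role k r u ≡ minWith u′ s
    role-max     : role k r u′ ≡ maxWith u s
    1≤u          : 1 ≤ u
    u≤b          : u ≤ b k
    1≤u′         : 1 ≤ u′
    u′≤b         : u′ ≤ b k
    comparator∈T : ∀ {i} → i + s < n k → (b k * i + u , b k * (i + s) + u′) ∈ Tlist k r

3≤k⇒1≤K : ∀ {k} → 3 ≤ k → 1 ≤ k ∸ 2
3≤k⇒1≤K (s≤s (s≤s (s≤s _))) = s≤s z≤n

module _ {k r : ℕ} (3≤k : 3 ≤ k) where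
  private
    K = k ∸ 2
    1≤K = 3≤k⇒1≤K 3≤k

  cyc-link : ≡₃ 1 r ≡ true → Link k r (b k) 1 1
  cyc-link cyc∈T = record
    { role-min = role-last k r 1≤K cyc∈T ; role-max = role-first k r 1≤K cyc∈T
    ; 1≤u = ≤-trans 1≤K (K≤b k) ; u≤b = ≤-refl ; 1≤u′ = ≤-refl ; u′≤b = ≤-trans 1≤K (K≤b k)
    ; comparator∈T = ∈-T-S1 {k} {r} cyc∈T ∘ ∈-S1⁺ {k} }

  module _ {j} (1≤j : 1 ≤ j) (j≤K : j ≤ K) where

    dec-link : ≡₃ (2 * j) r ≡ true → Link k r j (b k ∸ j + 1) (h k j)
    dec-link dec∈T = record
      { role-min = role-dec-left k r 1≤K 1≤j j≤K dec∈T ; role-max = role-dec-right k r 1≤K 1≤j j≤K dec∈T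
      ; 1≤u = 1≤j ; u≤b = ≤-trans j≤K (K≤b k) ; 1≤u′ = 1≤mirror (b k) j ; u′≤b = mirror-≤ 1≤j (≤-trans j≤K (K≤b k))
      ; comparator∈T = ∈-T-S2 {k} {r} 1≤j j≤K dec∈T ∘ ∈-S2⁺ {k} {j} }

    module _ (mov∈T : ≡₃ (2 * j + 1) r ≡ true) where

      mov-link-left : Link k r j (j + 1) 0
      mov-link-left = record
        { role-min = role-mov-left k r 1≤K 1≤j j≤K mov∈T ; role-max = role-mov-left′ k r 1≤K 1≤j j≤K mov∈T
        ; 1≤u = 1≤j ; u≤b = ≤-trans j≤K (K≤b k) ; 1≤u′ = m≤n+m 1 j
        ; u′≤b = ≤-trans (+-monoˡ-≤ 1 j≤K) (subst (_≤ b k) (+-comm 1 K) (K<2*K 1≤K))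
        ; comparator∈T = ∈-T-S3 {k} {r} 1≤j j≤K mov∈T ∘ proj₁ ∘ ∈-S3⁺ {k} {j} }

      mov-link-right : Link k r (b k ∸ j) (b k ∸ j + 1) 0
      mov-link-right = record
        { role-min = role-mov-right k r 1≤K 1≤j j≤K mov∈T ; role-max = role-mov-right′ k r 1≤K 1≤j j≤K mov∈T
        ; 1≤u = ≤-trans 1≤K (s≤s⁻¹ (subst (K <_) (+-comm (b k ∸ j) 1) (mirror-left-half j≤K)))
        ; u≤b = m∸n≤m (b k) j ; 1≤u′ = 1≤mirror (b k) j ; u′≤b = mirror-≤ 1≤j (≤-trans j≤K (K≤b k))
        ; comparator∈T = ∈-T-S3 {k} {r} 1≤j j≤K mov∈T ∘ proj₂ ∘ ∈-S3⁺ {k} {j} }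

data Covered (k r : ℕ) : ℕ → Set where
  cyc-first  : ≡₃ 1 r ≡ true → Covered k r 1
  cyc-last   : ≡₃ 1 r ≡ true → Covered k r (b k)
  dec-left   : ∀ {j} → 1 ≤ j → j ≤ k ∸ 2 → ≡₃ (2 * j) r ≡ true → Covered k r j
  dec-right  : ∀ {j} → 1 ≤ j → j ≤ k ∸ 2 → ≡₃ (2 * j) r ≡ true → Covered k r (b k ∸ j + 1)
  mov-left   : ∀ {j} → 1 ≤ j → j ≤ k ∸ 2 → ≡₃ (2 * j + 1) r ≡ true → Covered k r j
  mov-left′  : ∀ {j} → 1 ≤ j → j ≤ k ∸ 2 → ≡₃ (2 * j + 1) r ≡ true → Covered k r (j + 1)
  mov-right  : ∀ {j} → 1 ≤ j → j ≤ k ∸ 2 → ≡₃ (2 * j + 1) r ≡ true → Covered k r (b k ∸ j)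
  mov-right′ : ∀ {j} → 1 ≤ j → j ≤ k ∸ 2 → ≡₃ (2 * j + 1) r ≡ true → Covered k r (b k ∸ j + 1)

previous-layer : ∀ r {m} → 1 ≤ m → ≡₃ (2 * m) r ≡ false → ≡₃ (2 * m + 1) r ≡ false →
                 (m ≡ 1 × ≡₃ 1 r ≡ true) ⊎ ∃ λ j → m ≡ j + 1 × 1 ≤ j × ≡₃ (2 * j + 1) r ≡ true
previous-layer r {suc zero}    _ ¬S₂ ¬S₃ = inj₁ (refl , ≡₃-one-of-three 1 r ¬S₂ ¬S₃)
previous-layer r {suc (suc j)} _ ¬S₂ ¬S₃ = inj₂ (suc j , +-comm 1 (suc j) , s≤s z≤n ,
  ≡₃-one-of-three (2 * suc j + 1) r (subst (λ m → ≡₃ m r ≡ false) (shape₁ j) ¬S₂)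
                             (subst (λ m → ≡₃ m r ≡ false) (shape₂ j) ¬S₃))
  where
  shape₁ : ∀ j → 2 * suc (suc j) ≡ 1 + (2 * suc j + 1)
  shape₁ = solve-∀
  shape₂ : ∀ j → 2 * suc (suc j) + 1 ≡ 2 + (2 * suc j + 1)
  shape₂ = solve-∀

module _ {k r : ℕ} (1≤K : 1 ≤ k ∸ 2) where
  private
    K = k ∸ 2

  covered-left : ∀ {t} → 1 ≤ t → t ≤ K → Covered k r t
  covered-left {t} 1≤t t≤K with ≡₃ (2 * t) r in S₂ | ≡₃ (2 * t + 1) r in S₃
  ... | true  | _     = dec-left 1≤t t≤K S₂
  ... | false | true  = mov-left 1≤t t≤K S₃
  ... | false | false with previous-layer r 1≤t S₂ S₃
  ...   | inj₁ (refl , S₁) = cyc-first S₁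
  ...   | inj₂ (j , refl , 1≤j , S) = mov-left′ 1≤j (≤-trans (m≤m+n j 1) t≤K) S

  covered-right : ∀ {m} → 1 ≤ m → m ≤ K → Covered k r (b k ∸ m + 1)
  covered-right {m} 1≤m m≤K with ≡₃ (2 * m) r in S₂ | ≡₃ (2 * m + 1) r in S₃
  ... | true  | _     = dec-right 1≤m m≤K S₂
  ... | false | true  = mov-right′ 1≤m m≤K S₃
  ... | false | false with previous-layer r 1≤m S₂ S₃
  ...   | inj₁ (refl , S₁) = subst (Covered k r) (sym (m∸n+n≡m (≤-trans 1≤K (K≤b k)))) (cyc-last S₁)
  ...   | inj₂ (j , refl , 1≤j , S) =
    subst (Covered k r) (sym (trans (cong (λ z → b k ∸ z + 1) (+-comm j 1)) (∸-suc-+1 j+1≤b)))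
          (mov-right 1≤j (≤-trans (m≤m+n j 1) m≤K) S)
    where
    j+1≤b : suc j ≤ b k
    j+1≤b = ≤-trans (subst (_≤ K) (+-comm j 1) m≤K) (K≤b k)

  cover : ∀ {t} → 1 ≤ t → t ≤ b k → Covered k r t
  cover {t} 1≤t t≤b with t ≤? K
  ... | yes t≤K = covered-left 1≤t t≤K
  ... | no  t≰K = subst (Covered k r) (mirror-involutive 1≤t t≤b)
                    (covered-right (1≤mirror (b k) t) (mirror-right-half (≰⇒> t≰K) t≤b))

data Endpoint (k r t : ℕ) : Set where
  minEnd : ∀ {u′ s} → Link k r t u′ s → Endpoint k r t
  maxEnd : ∀ {u s} → Link k r u t s → Endpoint k r t

endpoint : ∀ {k r t} → 3 ≤ k → Covered k r t → Endpoint k r t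
endpoint 3≤k (cyc-first S)            = maxEnd (cyc-link 3≤k S)
endpoint 3≤k (cyc-last S)             = minEnd (cyc-link 3≤k S)
endpoint 3≤k (dec-left 1≤j j≤K S)     = minEnd (dec-link 3≤k 1≤j j≤K S)
endpoint 3≤k (dec-right 1≤j j≤K S)    = maxEnd (dec-link 3≤k 1≤j j≤K S)
endpoint 3≤k (mov-left 1≤j j≤K S)     = minEnd (mov-link-left 3≤k 1≤j j≤K S)
endpoint 3≤k (mov-left′ 1≤j j≤K S)    = maxEnd (mov-link-left 3≤k 1≤j j≤K S)
endpoint 3≤k (mov-right 1≤j j≤K S)    = minEnd (mov-link-right 3≤k 1≤j j≤K S)
endpoint 3≤k (mov-right′ 1≤j j≤K S)   = maxEnd (mov-link-right 3≤k 1≤j j≤K S)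

record FromLink (k r : ℕ) (d : Comparator) : Set where
  constructor fromLink
  field
    {row col col′ shift} : ℕ
    link     : Link k r col col′ shift
    in-range : row + shift < n k
    shape    : d ≡ (b k * row + col , b k * (row + shift) + col′)

layer-size≤n : ∀ {k j} → 2 ≤ k → 1 ≤ j → 2 ^ (k ∸ j ∸ 1) ≤ n k
layer-size≤n {suc (suc k)} {suc j} (s≤s (s≤s _)) _ =
  ≤-trans (^-monoʳ-≤ 2 (∸-monoˡ-≤ 1 (m∸n≤m (suc k) j))) (m+n≤o⇒m≤o∸n (2 ^ k) Q+1≤2*Q)
  where
  Q+1≤2*Q : 2 ^ k + 1 ≤ 2 * 2 ^ k
  Q+1≤2*Q = subst (2 ^ k + 1 ≤_) (cong (λ z → 2 ^ k + z) (sym (+-identityʳ (2 ^ k))))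
                  (+-monoʳ-≤ (2 ^ k) (m^n>0 2 k))

module _ {k r : ℕ} (3≤k : 3 ≤ k) where
  private
    2≤k : 2 ≤ k
    2≤k = ≤-trans (n≤1+n 2) 3≤k

  comparator-from-link : ∀ {d} → d ∈ Tlist k r → FromLink k r d
  comparator-from-link d∈ with ∈-++⁻ (if ≡₃ 1 r then S1 k else []) d∈
  ... | inj₁ d∈S1′ with ∈-if⁻ (≡₃ 1 r) d∈S1′
  ...   | S₁ , d∈S1 with ∈-S1⁻ {k} d∈S1
  ...     | i , i+1<n , refl = fromLink (cyc-link 3≤k S₁) i+1<n refl
  comparator-from-link d∈ | inj₂ d∈layers with ∈-concatMap⁻ (layers k r) (oneTo (k ∸ 2)) d∈layers
  ... | j , j∈ , d∈layer with ∈-oneTo⁻ j∈ | ∈-++⁻ (if ≡₃ (2 * j) r then S2 k j else []) d∈layer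
  ...   | 1≤j , j≤K | inj₁ d∈S2′ with ∈-if⁻ (≡₃ (2 * j) r) d∈S2′
  ...     | S₂ , d∈S2 with ∈-S2⁻ {k} {j} (layer-size≤n 2≤k 1≤j) d∈S2
  ...       | i , i+h<n , refl = fromLink (dec-link 3≤k 1≤j j≤K S₂) i+h<n refl
  comparator-from-link d∈ | inj₂ _ | j , _ , _ | 1≤j , j≤K | inj₂ d∈S3′
    with ∈-if⁻ (≡₃ (2 * j + 1) r) d∈S3′
  ... | S₃ , d∈S3 with ∈-S3⁻ {k} {j} d∈S3
  ...   | i , i<n , inj₁ refl = fromLink (mov-link-left 3≤k 1≤j j≤K S₃) i<n refl
  ...   | i , i<n , inj₂ refl = fromLink (mov-link-right 3≤k 1≤j j≤K S₃) i<n refl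

-- Disjointness

earlier-row-< : ∀ B {i i′ u u′} → u ≤ B → 1 ≤ u′ → i < i′ → B * i + u < B * i′ + u′
earlier-row-< B {i} {i′} {u} {u′} u≤B 1≤u′ i<i′ = begin-strict
  B * i + u   ≤⟨ +-monoʳ-≤ (B * i) u≤B ⟩
  B * i + B   ≡⟨ +-comm (B * i) B ⟩
  B + B * i   ≡⟨ *-suc B i ⟨
  B * suc i   ≤⟨ *-monoʳ-≤ B i<i′ ⟩
  B * i′      <⟨ m<m+n (B * i′) 1≤u′ ⟩
  B * i′ + u′ ∎
  where open ≤-Reasoning

row-col-injective : ∀ B {i i′ u u′} → 1 ≤ u → u ≤ B → 1 ≤ u′ → u′ ≤ B →
                    B * i + u ≡ B * i′ + u′ → i ≡ i′ × u ≡ u′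
row-col-injective B {i} {i′} 1≤u u≤B 1≤u′ u′≤B eq with <-cmp i i′
... | tri< i<i′ _ _ = ⊥-elim (<⇒≢ (earlier-row-< B u≤B 1≤u′ i<i′) eq)
... | tri≈ _ refl _ = refl , +-cancelˡ-≡ (B * i) _ _ eq
... | tri> _ _ i′<i = ⊥-elim (<⇒≢ (earlier-row-< B u′≤B 1≤u i′<i) (sym eq))

minWith-injective : ∀ {u v s t} → minWith u s ≡ minWith v t → u ≡ v × s ≡ t
minWith-injective refl = refl , refl

maxWith-injective : ∀ {u v s t} → maxWith u s ≡ maxWith v t → u ≡ v × s ≡ t
maxWith-injective refl = refl , refl

minWith≢maxWith : ∀ {u v s t} → minWith u s ≢ maxWith v t
minWith≢maxWith ()

-- A comparator touching an end of the link L lies on a link sharing a column with L; the role of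
-- that column then forces the two links, and the two comparators, to coincide.
module _ {k r : ℕ} (3≤k : 3 ≤ k) {u u′ s : ℕ} (L : Link k r u u′ s) where
  open Link

  private
    same-column : ∀ {i i′ w w′} → 1 ≤ w → w ≤ b k → 1 ≤ w′ → w′ ≤ b k →
                  b k * i + w ≡ b k * i′ + w′ → i ≡ i′ × w ≡ w′
    same-column = row-col-injective (b k)

    min-end : ∀ {d} → FromLink k r d → ∀ {i} → proj₁ d ≡ b k * i + u →
              d ≡ (b k * i + u , b k * (i + s) + u′) × i + s < n k
    min-end (fromLink L′ in-range refl) eq with same-column (1≤u L′) (u≤b L′) (1≤u L) (u≤b L) eq
    ... | refl , refl with minWith-injective (trans (sym (role-min L′)) (role-min L))
    ...   | refl , refl = refl , in-range

    max-end : ∀ {d} → FromLink k r d → ∀ {m} → proj₂ d ≡ b k * m + u′ →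
              ∃ λ i → m ≡ i + s × d ≡ (b k * i + u , b k * (i + s) + u′)
    max-end (fromLink {i} L′ _ refl) eq with same-column (1≤u′ L′) (u′≤b L′) (1≤u′ L) (u′≤b L) eq
    ... | refl , refl with maxWith-injective (trans (sym (role-max L′)) (role-max L))
    ...   | refl , refl = i , refl , refl

    min-end-not-at-u′ : ∀ {d} → FromLink k r d → ∀ {m} → proj₁ d ≢ b k * m + u′
    min-end-not-at-u′ (fromLink L′ _ refl) eq with same-column (1≤u L′) (u≤b L′) (1≤u′ L) (u′≤b L) eq
    ... | _ , refl = minWith≢maxWith (trans (sym (role-min L′)) (role-max L))

    max-end-not-at-u : ∀ {d} → FromLink k r d → ∀ {m} → proj₂ d ≢ b k * m + u
    max-end-not-at-u (fromLink L′ _ refl) eq with same-column (1≤u′ L′) (u′≤b L′) (1≤u L) (u≤b L) eq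
    ... | _ , refl = minWith≢maxWith (trans (sym (role-min L)) (role-max L′))

  link-isolated : ∀ i → Isolated (Tlist k r) (b k * i + u) (b k * (i + s) + u′)
  link-isolated i {x , y} d∈ with comparator-from-link 3≤k d∈
  ... | F with x ≟ b k * i + u | y ≟ b k * (i + s) + u′
  ...   | yes x≡ | _     = inj₁ (proj₁ (min-end F x≡))
  ...   | no  x≢ | no y≢ = inj₂ ((x≢ , max-end-not-at-u F) , (min-end-not-at-u′ F , y≢))
  ...   | no  _  | yes y≡ with max-end F y≡
  ...     | i₁ , eq , d≡ with +-cancelʳ-≡ s i i₁ eq
  ...       | refl = inj₁ d≡

  link-ends-differ : ∀ i → b k * i + u ≢ b k * (i + s) + u′
  link-ends-differ i eq with same-column (1≤u L) (u≤b L) (1≤u′ L) (u′≤b L) eq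
  ... | _ , refl = minWith≢maxWith (trans (sym (role-min L)) (role-max L))

  min-end-unpaired : ∀ {i} → n k ≤ i + s → ∀ {d} → d ∈ Tlist k r → Avoids d (b k * i + u)
  min-end-unpaired i+s≥n d∈ = let F = comparator-from-link 3≤k d∈ in
    (λ x≡ → <⇒≱ (proj₂ (min-end F x≡)) i+s≥n) , max-end-not-at-u F

  max-end-unpaired : ∀ {i} → i < s → ∀ {d} → d ∈ Tlist k r → Avoids d (b k * i + u′)
  max-end-unpaired i<s d∈ = let F = comparator-from-link 3≤k d∈ in
    min-end-not-at-u′ F , λ y≡ → let (i₁ , i≡ , _) = max-end F y≡ in
      <⇒≱ i<s (subst (s ≤_) (sym i≡) (m≤n+m s i₁))

-- The columns after one layer

SortedColumn : ℕ → (ℕ → Bool) → ℕ → ℕ → Set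
SortedColumn k f t a = ∀ {i} → i < n k → f (b k * i + t) ≡ stepBit a i

module _ {k r : ℕ} (3≤k : 3 ≤ k) {u u′ s : ℕ} (L : Link k r u u′ s) (f : ℕ → Bool) where
  private
    F = foldl applyComp f (Tlist k r)

    sorts : ∀ {i} → i + s < n k → SortsPair f F (b k * i + u) (b k * (i + s) + u′)
    sorts {i} i+s<n = foldl-applyComp-isolated (link-ends-differ 3≤k L i) (Tlist k r) f
                        (link-isolated 3≤k L i) (Link.comparator∈T L i+s<n)

  min-column : ∀ {a a′} → a′ ≤ n k → SortedColumn k f u a → SortedColumn k f u′ a′ →
               SortedColumn k F u (a ⊔ (a′ ∸ s))
  min-column {a} {a′} a′≤n col col′ {i} i<n =
    trans (F≡ (i + s <? n k))
          (sym (trans (stepBit-⊔ a (a′ ∸ s) i) (cong (stepBit a i ∧_) (stepBit-∸ a′ s i))))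
    where
    F≡ : Dec (i + s < n k) → F (b k * i + u) ≡ stepBit a i ∧ stepBit a′ (i + s)
    F≡ (yes i+s<n) = trans (proj₁ (sorts i+s<n)) (cong₂ _∧_ (col i<n) (col′ i+s<n))
    F≡ (no  i+s≮n) = begin
      F (b k * i + u)                  ≡⟨ foldl-applyComp-avoiding (Tlist k r) f (min-end-unpaired 3≤k L n≤i+s) ⟩
      f (b k * i + u)                  ≡⟨ col i<n ⟩
      stepBit a i                      ≡⟨ ∧-identityʳ (stepBit a i) ⟨
      stepBit a i ∧ true               ≡⟨ cong (stepBit a i ∧_) (stepBit-≤ (≤-trans a′≤n n≤i+s)) ⟨
      stepBit a i ∧ stepBit a′ (i + s) ∎
      where
      open ≡-Reasoning
      n≤i+s = ≮⇒≥ i+s≮n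

  max-column : ∀ {a a′} → SortedColumn k f u a → SortedColumn k f u′ a′ →
               SortedColumn k F u′ ((a + s) ⊓ a′)
  max-column {a} {a′} col col′ {i} i<n =
    trans (F≡ (s ≤? i)) (sym (stepBit-⊓ (a + s) a′ i))
    where
    shifted : ∀ {i₀} → i₀ + s < n k → F (b k * (i₀ + s) + u′) ≡ stepBit (a + s) (i₀ + s) ∨ stepBit a′ (i₀ + s)
    shifted {i₀} i₀+s<n = trans (proj₂ (sorts i₀+s<n))
      (cong₂ _∨_ (trans (col (≤-trans (s≤s (m≤m+n i₀ s)) i₀+s<n)) (sym (stepBit-+ a s i₀))) (col′ i₀+s<n))
    F≡ : Dec (s ≤ i) → F (b k * i + u′) ≡ stepBit (a + s) i ∨ stepBit a′ i
    F≡ (yes s≤i) = subst (λ m → F (b k * m + u′) ≡ stepBit (a + s) m ∨ stepBit a′ m) (m∸n+n≡m s≤i)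
                         (shifted (subst (_< n k) (sym (m∸n+n≡m s≤i)) i<n))
    F≡ (no  s≰i) = begin
      F (b k * i + u′)                 ≡⟨ foldl-applyComp-avoiding (Tlist k r) f (max-end-unpaired 3≤k L i<s) ⟩
      f (b k * i + u′)                 ≡⟨ col′ i<n ⟩
      stepBit a′ i                     ≡⟨ cong (_∨ stepBit a′ i) (stepBit-> (≤-trans i<s (m≤n+m s a))) ⟨
      stepBit (a + s) i ∨ stepBit a′ i ∎
      where
      open ≡-Reasoning
      i<s = ≰⇒> s≰i

atL-tabulate : ∀ m (G : ℕ → Bool) {p} → p < m → atL (toList (tabulate {n = m} (G ∘ toℕ))) p ≡ G p
atL-tabulate (suc m) G {zero}  _         = refl
atL-tabulate (suc m) G {suc p} (s≤s p<m) = atL-tabulate m (G ∘ suc) p<m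

atZ-tabulate : ∀ m (G : ℕ → ℤ) {p} → p < m → atZ (toList (tabulate {n = m} (G ∘ toℕ))) p ≡ G p
atZ-tabulate (suc m) G {zero}  _         = refl
atZ-tabulate (suc m) G {suc p} (s≤s p<m) = atZ-tabulate m (G ∘ suc) p<m

entry-colCounts : ∀ k x {t} → 1 ≤ t → t ≤ b k → entry (colCounts k x) t ≡ + ones (colWord k x t)
entry-colCounts k x {suc t} _ t<b = atZ-tabulate (b k) (λ p → + ones (colWord k x (suc p))) t<b

module _ (k : ℕ) where

  register : ∀ i t → t + i * b k ≡ b k * i + t
  register i t = trans (+-comm t (i * b k)) (cong (_+ t) (*-comm i (b k)))

  register≤N : ∀ {i t} → i < n k → t ≤ b k → t + i * b k ≤ N k
  register≤N {i} i<n t≤b = ≤-trans (+-monoˡ-≤ (i * b k) t≤b) (*-monoˡ-≤ (b k) i<n)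

  sorted-column : ∀ (y : Vec Bool (N k)) {t} → Sorted01 (colWord k y t) →
                  SortedColumn k (reg y) t (n k ∸ ones (colWord k y t))
  sorted-column y {t} sorted {i} i<n = begin
    reg y (b k * i + t)                                   ≡⟨ cong (reg y) (register i t) ⟨
    reg y (t + i * b k)                                   ≡⟨ atL-map-upTo _ (n k) i<n ⟨
    atL (colWord k y t) i                                 ≡⟨ atL-sorted sorted (subst (i <_) (sym len) i<n) ⟩
    stepBit (length (colWord k y t) ∸ ones (colWord k y t)) i
                                                          ≡⟨ cong (λ m → stepBit (m ∸ ones (colWord k y t)) i) len ⟩
    stepBit (n k ∸ ones (colWord k y t)) i                ∎
    where
    open ≡-Reasoning
    len = length-map-upTo (λ i → reg y (t + i * b k)) (n k)

  ones-sorted-column : ∀ (y : Vec Bool (N k)) {t a} → SortedColumn k (reg y) t a → ones (colWord k y t) ≡ n k ∸ a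
  ones-sorted-column y {t} {a} sorted = trans (cong ones (map-cong-upTo (n k) bit)) (ones-stepBits a (n k))
    where
    bit : ∀ {i} → i < n k → reg y (t + i * b k) ≡ stepBit a i
    bit {i} i<n = trans (cong (reg y) (register i t)) (sorted i<n)

  ones≤n : ∀ (y : Vec Bool (N k)) t → ones (colWord k y t) ≤ n k
  ones≤n y t = subst (ones (colWord k y t) ≤_) (length-map-upTo _ (n k)) (ones≤length (colWord k y t))

  reg-T : ∀ r x {p} → 1 ≤ p → p ≤ N k → reg (T k r x) p ≡ foldl applyComp (reg x) (Tlist k r) p
  reg-T r x {suc p} _ p<N = atL-tabulate (N k) (λ q → foldl applyComp (reg x) (Tlist k r) (suc q)) p<N

  sortedColumn-T : ∀ r x {t a} → 1 ≤ t → t ≤ b k → SortedColumn k (foldl applyComp (reg x) (Tlist k r)) t a →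
                   SortedColumn k (reg (T k r x)) t a
  sortedColumn-T r x {t} 1≤t t≤b sorted {i} i<n =
    trans (reg-T r x (≤-trans 1≤t (m≤n+m t (b k * i))) (subst (_≤ N k) (register i t) (register≤N i<n t≤b)))
          (sorted i<n)

updatedCount : Role → (ℕ → ℤ) → ℕ → ℤ
updatedCount (minWith u s) c t = c t ℤ.⊓ (c u ℤ.+ + s)
updatedCount (maxWith u s) c t = (c u ℤ.- + s) ℤ.⊔ c t

module _ {k : ℕ} (3≤k : 3 ≤ k) (x : Vec Bool (N k))
         (sorted : (j : ℕ) → 1 ≤ j → j ≤ b k → Sorted01 (colWord k x j)) (r : ℕ) where
  private
    count zeros : ℕ → ℕ
    count t = ones (colWord k x t)
    zeros t = n k ∸ count t

    C : ℕ → ℤ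
    C = entry (colCounts k x)

    C≡ : ∀ {t} → 1 ≤ t → t ≤ b k → C t ≡ + count t
    C≡ = entry-colCounts k x

    column : ∀ {t} → 1 ≤ t → t ≤ b k → SortedColumn k (reg x) t (zeros t)
    column {t} 1≤t t≤b = sorted-column k x (sorted t 1≤t t≤b)

    ones-T-column : ∀ {t} a → 1 ≤ t → t ≤ b k → SortedColumn k (foldl applyComp (reg x) (Tlist k r)) t a →
                    + ones (colWord k (T k r x) t) ≡ + (n k ∸ a)
    ones-T-column a 1≤t t≤b col =
      cong +_ (ones-sorted-column k (T k r x) {a = a} (sortedColumn-T k r x {a = a} 1≤t t≤b col))

  ones-T≡updatedCount : ∀ {t} → 1 ≤ t → t ≤ b k →
                        + ones (colWord k (T k r x) t) ≡ updatedCount (role k r t) C t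
  ones-T≡updatedCount {t} 1≤t t≤b with endpoint {r = r} 3≤k (cover (3≤k⇒1≤K 3≤k) 1≤t t≤b)
  ... | minEnd {u′} {s} L = begin
    + ones (colWord k (T k r x) t)       ≡⟨ ones-T-column (zeros t ⊔ (zeros u′ ∸ s)) 1≤t t≤b after ⟩
    + (n k ∸ (zeros t ⊔ (zeros u′ ∸ s))) ≡⟨ ones-min-shifted (n k) (count t) (count u′) s (ones≤n k x t) (ones≤n k x u′) ⟩
    + count t ℤ.⊓ (+ count u′ ℤ.+ + s)   ≡⟨ cong₂ (λ p q → p ℤ.⊓ (q ℤ.+ + s)) (C≡ 1≤t t≤b) (C≡ 1≤u′ u′≤b) ⟨
    updatedCount (minWith u′ s) C t      ≡⟨ cong (λ ρ → updatedCount ρ C t) (Link.role-min L) ⟨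
    updatedCount (role k r t) C t        ∎
    where
    open ≡-Reasoning
    open Link L using (1≤u′; u′≤b)
    after = min-column 3≤k L (reg x) {zeros t} {zeros u′} (m∸n≤m (n k) (count u′)) (column 1≤t t≤b) (column 1≤u′ u′≤b)
  ... | maxEnd {u} {s} L = begin
    + ones (colWord k (T k r x) t)       ≡⟨ ones-T-column ((zeros u + s) ⊓ zeros t) 1≤t t≤b after ⟩
    + (n k ∸ ((zeros u + s) ⊓ zeros t))  ≡⟨ ones-max-shifted (n k) (count u) (count t) s (ones≤n k x u) (ones≤n k x t) ⟩
    (+ count u ℤ.- + s) ℤ.⊔ + count t    ≡⟨ cong₂ (λ p q → (p ℤ.- + s) ℤ.⊔ q) (C≡ 1≤u u≤b) (C≡ 1≤t t≤b) ⟨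
    updatedCount (maxWith u s) C t       ≡⟨ cong (λ ρ → updatedCount ρ C t) (Link.role-max L) ⟨
    updatedCount (role k r t) C t        ∎
    where
    open ≡-Reasoning
    open Link L using (1≤u; u≤b)
    after = max-column 3≤k L (reg x) {zeros u} {zeros t} (column 1≤u u≤b) (column 1≤t t≤b)

-- The maps Q^k_r

any-≡ᵇ⁺ : ∀ {t as} → t ∈ as → any (λ s → s ≡ᵇ t) as ≡ true
any-≡ᵇ⁺ {t} t∈ = Equivalence.to T-≡ (any⁺ _ (Any.map (λ {s} t≡s → ≡⇒≡ᵇ s t (sym t≡s)) t∈))

any-≡ᵇ⁻ : ∀ {t} as → any (λ s → s ≡ᵇ t) as ≡ true → t ∈ as
any-≡ᵇ⁻ {t} as e = Any.map (λ {s} s≡ᵇt → sym (≡ᵇ⇒≡ s t s≡ᵇt)) (any⁻ _ as (Equivalence.from T-≡ e))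

applyQ-unique : ∀ ops c t v → (∀ {o} → o ∈ ops → t ∈ Op.args o → Op.fun o c t ≡ v) →
                (∃ λ o → o ∈ ops × t ∈ Op.args o) → applyQ ops c t ≡ v
applyQ-unique (op f as ∷ ops) c t v agree (o , o∈ , t∈) with any (λ s → s ≡ᵇ t) as in e
... | true  = agree (here refl) (any-≡ᵇ⁻ as e)
... | false with o∈
...   | here refl = contradiction (trans (sym (any-≡ᵇ⁺ t∈)) e) λ ()
...   | there o∈ops = applyQ-unique ops c t v (agree ∘ there) (o , o∈ops , t∈)

module _ {k r : ℕ} (1≤K : 1 ≤ k ∸ 2) (c : ℕ → ℤ) where
  private
    K = k ∸ 2

    role-value : ∀ {t ρ v} → role k r t ≡ ρ → v ≡ updatedCount ρ c t → v ≡ updatedCount (role k r t) c t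
    role-value role≡ v≡ = trans v≡ (cong (λ ρ → updatedCount ρ c _) (sym role≡))

    b≢1 : b k ≢ 1
    b≢1 b≡1 = <⇒≢ (≤-trans (s≤s 1≤K) (K<2*K 1≤K)) (sym b≡1)

    min+0 : ∀ t u → c t ℤ.⊓ c u ≡ c t ℤ.⊓ (c u ℤ.+ + 0)
    min+0 t u = cong (c t ℤ.⊓_) (sym (ℤ.+-identityʳ (c u)))

    max-0 : ∀ u t → c (u + 1 ∸ 1) ℤ.⊔ c t ≡ (c u ℤ.- + 0) ℤ.⊔ c t
    max-0 u t = cong (ℤ._⊔ c t) (trans (cong c (m+n∸n≡m u 1)) (sym (ℤ.+-identityʳ (c u))))

  cyc-value : ≡₃ 1 r ≡ true → ∀ {t} → t ∈ Op.args (cyc k) → Op.fun (cyc k) c t ≡ updatedCount (role k r t) c t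
  cyc-value S (here refl) = role-value (role-first k r 1≤K S) (ℤ.⊔-comm (c 1) _)
  cyc-value S (there (here refl)) = role-value (role-last k r 1≤K S)
    (trans (if-false (≢⇒≡ᵇ-false b≢1)) (trans (if-true (≡ᵇ-refl (b k))) (ℤ.⊓-comm _ (c (b k)))))

  module _ {j} (1≤j : 1 ≤ j) (j≤K : j ≤ K) where
    private
      mirror≢j : b k ∸ j + 1 ≢ j
      mirror≢j eq = <⇒≢ (≤-trans (s≤s j≤K) (mirror-left-half j≤K)) (sym eq)

      ∨-true : ∀ {x y} → y ≡ true → x ∨ y ≡ true
      ∨-true {x} refl = ∨-zeroʳ x

    dec-value : ≡₃ (2 * j) r ≡ true → ∀ {t} → t ∈ Op.args (dec k j) →
                Op.fun (dec k j) c t ≡ updatedCount (role k r t) c t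
    dec-value S (here refl) = role-value (role-dec-left k r 1≤K 1≤j j≤K S) (if-true (≡ᵇ-refl j))
    dec-value S (there (here refl)) = role-value (role-dec-right k r 1≤K 1≤j j≤K S)
      (trans (if-false (≢⇒≡ᵇ-false mirror≢j)) (if-true (≡ᵇ-refl (b k ∸ j + 1))))

    mov-value : ≡₃ (2 * j + 1) r ≡ true → ∀ {t} → t ∈ Op.args (mov k j) →
                Op.fun (mov k j) c t ≡ updatedCount (role k r t) c t
    mov-value S (here refl) = role-value (role-mov-left k r 1≤K 1≤j j≤K S)
      (trans (if-true (cong (_∨ (j ≡ᵇ b k ∸ j)) (≡ᵇ-refl j))) (min+0 j (j + 1)))
    mov-value S (there (here refl)) = role-value (role-mov-left′ k r 1≤K 1≤j j≤K S)
      (trans (if-false (cong₂ _∨_ (≢⇒≡ᵇ-false (m+1≢m j)) (≢⇒≡ᵇ-false (mirror-parity j≤K))))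
        (trans (if-true (cong (_∨ (j + 1 ≡ᵇ b k ∸ j + 1)) (≡ᵇ-refl (j + 1)))) (max-0 j (j + 1))))
    mov-value S (there (there (here refl))) = role-value (role-mov-right k r 1≤K 1≤j j≤K S)
      (trans (if-true (∨-true {b k ∸ j ≡ᵇ j} (≡ᵇ-refl (b k ∸ j)))) (min+0 (b k ∸ j) (b k ∸ j + 1)))
    mov-value S (there (there (there (here refl)))) = role-value (role-mov-right′ k r 1≤K 1≤j j≤K S)
      (trans (if-false (cong₂ _∨_ (≢⇒≡ᵇ-false mirror≢j) (≢⇒≡ᵇ-false (m+1≢m (b k ∸ j)))))
        (trans (if-true (∨-true {b k ∸ j + 1 ≡ᵇ j + 1} (≡ᵇ-refl (b k ∸ j + 1))))
          (max-0 (b k ∸ j) (b k ∸ j + 1))))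

data LayerIndex : ℕ → Set where
  layer₁ : LayerIndex 1
  layer₂ : LayerIndex 2
  layer₃ : LayerIndex 3

layerIndex : ∀ {r} → 1 ≤ r → r ≤ 3 → LayerIndex r
layerIndex {1} _ _ = layer₁
layerIndex {2} _ _ = layer₂
layerIndex {3} _ _ = layer₃
layerIndex {suc (suc (suc (suc _)))} _ (s≤s (s≤s (s≤s ())))

decResidue movResidue : ℕ → ℕ
decResidue 1 = 2
decResidue 2 = 1
decResidue _ = 0
movResidue 1 = 0
movResidue 2 = 2
movResidue _ = 1

Qops-shape : ∀ k {r} → LayerIndex r →
             Qops k r ≡ (if ≡₃ 1 r then cyc k ∷ [] else [])
                        ++ (map (dec k) (idxs k (decResidue r)) ++ map (mov k) (idxs k (movResidue r)))
Qops-shape k layer₁ = refl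
Qops-shape k layer₂ = refl
Qops-shape k layer₃ = refl

≡₃-residue : ∀ s r (f : ℕ → ℕ) → (∀ j → f (3 + j) ≡ 3 + (3 + f j)) →
             ≡₃ 0 s ≡ ≡₃ (f 0) r → ≡₃ 1 s ≡ ≡₃ (f 1) r → ≡₃ 2 s ≡ ≡₃ (f 2) r →
             ∀ j → ≡₃ j s ≡ ≡₃ (f j) r
≡₃-residue s r f f-shift e₀ e₁ e₂ 0 = e₀
≡₃-residue s r f f-shift e₀ e₁ e₂ 1 = e₁
≡₃-residue s r f f-shift e₀ e₁ e₂ 2 = e₂
≡₃-residue s r f f-shift e₀ e₁ e₂ (suc (suc (suc j))) = begin
  ≡₃ (3 + j) s               ≡⟨ ≡₃-periodic j s ⟩
  ≡₃ j s                     ≡⟨ ≡₃-residue s r f f-shift e₀ e₁ e₂ j ⟩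
  ≡₃ (f j) r                 ≡⟨ ≡₃-periodic (f j) r ⟨
  ≡₃ (3 + f j) r             ≡⟨ ≡₃-periodic (3 + f j) r ⟨
  ≡₃ (3 + (3 + f j)) r       ≡⟨ cong (λ m → ≡₃ m r) (f-shift j) ⟨
  ≡₃ (f (3 + j)) r           ∎
  where open ≡-Reasoning

decResidue-correct : ∀ {r} → LayerIndex r → ∀ j → ≡₃ j (decResidue r) ≡ ≡₃ (2 * j) r
decResidue-correct layer₁ = ≡₃-residue 2 1 (2 *_) (*-distribˡ-+ 2 3) refl refl refl
decResidue-correct layer₂ = ≡₃-residue 1 2 (2 *_) (*-distribˡ-+ 2 3) refl refl refl
decResidue-correct layer₃ = ≡₃-residue 0 3 (2 *_) (*-distribˡ-+ 2 3) refl refl refl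

movResidue-correct : ∀ {r} → LayerIndex r → ∀ j → ≡₃ j (movResidue r) ≡ ≡₃ (2 * j + 1) r
movResidue-correct layer₁ = ≡₃-residue 0 1 (λ j → 2 * j + 1) (cong (_+ 1) ∘ *-distribˡ-+ 2 3) refl refl refl
movResidue-correct layer₂ = ≡₃-residue 2 2 (λ j → 2 * j + 1) (cong (_+ 1) ∘ *-distribˡ-+ 2 3) refl refl refl
movResidue-correct layer₃ = ≡₃-residue 1 3 (λ j → 2 * j + 1) (cong (_+ 1) ∘ *-distribˡ-+ 2 3) refl refl refl

∈-idxs⁺ : ∀ {k s j} → 1 ≤ j → j ≤ k ∸ 2 → ≡₃ j s ≡ true → j ∈ idxs k s
∈-idxs⁺ {k} {s} {suc j} _ j<K e =
  ∈-concatMap⁺ (λ i → if ≡₃ i s then i ∷ [] else []) (∈-if⁺ e (here refl)) (∈-oneTo⁺ j<K)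

∈-idxs⁻ : ∀ {k s j} → j ∈ idxs k s → (1 ≤ j × j ≤ k ∸ 2) × ≡₃ j s ≡ true
∈-idxs⁻ {k} {s} j∈ with ∈-concatMap⁻ (λ i → if ≡₃ i s then i ∷ [] else []) (oneTo (k ∸ 2)) j∈
... | i , i∈ , j∈′ with ∈-if⁻ (≡₃ i s) j∈′
...   | e , here refl = ∈-oneTo⁻ i∈ , e

data QOp (k r : ℕ) : Op → Set where
  cyc-op : ≡₃ 1 r ≡ true → QOp k r (cyc k)
  dec-op : ∀ {j} → 1 ≤ j → j ≤ k ∸ 2 → ≡₃ (2 * j) r ≡ true → QOp k r (dec k j)
  mov-op : ∀ {j} → 1 ≤ j → j ≤ k ∸ 2 → ≡₃ (2 * j + 1) r ≡ true → QOp k r (mov k j)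

module _ (k : ℕ) {r} (ℓ : LayerIndex r) where

  ∈-Qops⁺ : ∀ {o} → QOp k r o → o ∈ Qops k r
  ∈-Qops⁺ q rewrite Qops-shape k ℓ = go q
    where
    go : ∀ {o} → QOp k r o → o ∈ (if ≡₃ 1 r then cyc k ∷ [] else [])
                                   ++ (map (dec k) (idxs k (decResidue r)) ++ map (mov k) (idxs k (movResidue r)))
    go (cyc-op S) = ∈-++⁺ˡ (∈-if⁺ S (here refl))
    go (dec-op {j} 1≤j j≤K S) = ∈-++⁺ʳ (if ≡₃ 1 r then cyc k ∷ [] else []) (∈-++⁺ˡ (∈-map⁺ (dec k)
      (∈-idxs⁺ {k} {decResidue r} 1≤j j≤K (trans (decResidue-correct ℓ j) S))))
    go (mov-op {j} 1≤j j≤K S) = ∈-++⁺ʳ (if ≡₃ 1 r then cyc k ∷ [] else [])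
      (∈-++⁺ʳ (map (dec k) (idxs k (decResidue r)))
        (∈-map⁺ (mov k) (∈-idxs⁺ {k} {movResidue r} 1≤j j≤K (trans (movResidue-correct ℓ j) S))))

  ∈-Qops⁻ : ∀ {o} → o ∈ Qops k r → QOp k r o
  ∈-Qops⁻ o∈ rewrite Qops-shape k ℓ with ∈-++⁻ (if ≡₃ 1 r then cyc k ∷ [] else []) o∈
  ... | inj₁ o∈cyc with ∈-if⁻ (≡₃ 1 r) o∈cyc
  ...   | S , here refl = cyc-op S
  ∈-Qops⁻ o∈ | inj₂ o∈ops with ∈-++⁻ (map (dec k) (idxs k (decResidue r))) o∈ops
  ... | inj₁ o∈dec with ∈-map⁻ (dec k) o∈dec
  ...   | j , j∈ , refl = let ((1≤j , j≤K) , S) = ∈-idxs⁻ {k} {decResidue r} j∈ in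
    dec-op 1≤j j≤K (trans (sym (decResidue-correct ℓ j)) S)
  ∈-Qops⁻ o∈ | inj₂ o∈ops | inj₂ o∈mov with ∈-map⁻ (mov k) o∈mov
  ... | j , j∈ , refl = let ((1≤j , j≤K) , S) = ∈-idxs⁻ {k} {movResidue r} j∈ in
    mov-op 1≤j j≤K (trans (sym (movResidue-correct ℓ j)) S)

covered-op : ∀ {k r t} → Covered k r t → ∃ λ o → QOp k r o × t ∈ Op.args o
covered-op {k} (cyc-first S)               = cyc k , cyc-op S , here refl
covered-op {k} (cyc-last S)                = cyc k , cyc-op S , there (here refl)
covered-op {k} (dec-left {j} 1≤j j≤K S)    = dec k j , dec-op 1≤j j≤K S , here refl
covered-op {k} (dec-right {j} 1≤j j≤K S)   = dec k j , dec-op 1≤j j≤K S , there (here refl)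
covered-op {k} (mov-left {j} 1≤j j≤K S)    = mov k j , mov-op 1≤j j≤K S , here refl
covered-op {k} (mov-left′ {j} 1≤j j≤K S)   = mov k j , mov-op 1≤j j≤K S , there (here refl)
covered-op {k} (mov-right {j} 1≤j j≤K S)   = mov k j , mov-op 1≤j j≤K S , there (there (here refl))
covered-op {k} (mov-right′ {j} 1≤j j≤K S)  = mov k j , mov-op 1≤j j≤K S , there (there (there (here refl)))

applyQ≡updatedCount : ∀ k {r} → LayerIndex r → 3 ≤ k → ∀ c {t} → 1 ≤ t → t ≤ b k →
                      applyQ (Qops k r) c t ≡ updatedCount (role k r t) c t
applyQ≡updatedCount k {r} ℓ 3≤k c {t} 1≤t t≤b =
  applyQ-unique (Qops k r) c t _ (λ o∈ → value (∈-Qops⁻ k ℓ o∈))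
    (let (o , q , t∈) = covered-op (cover 1≤K 1≤t t≤b) in o , ∈-Qops⁺ k ℓ q , t∈)
  where
  1≤K = 3≤k⇒1≤K 3≤k
  value : ∀ {o t} → QOp k r o → t ∈ Op.args o → Op.fun o c t ≡ updatedCount (role k r t) c t
  value (cyc-op S)          = cyc-value {k} {r} 1≤K c S
  value (dec-op 1≤j j≤K S) = dec-value {k} {r} 1≤K c 1≤j j≤K S
  value (mov-op 1≤j j≤K S) = mov-value {k} {r} 1≤K c 1≤j j≤K S

lemma2 : (k : ℕ) → 3 ≤ k → (x : Vec Bool (N k))
    → ((j : ℕ) → 1 ≤ j → j ≤ b k → Sorted01 (colWord k x j))
    → (r : ℕ) → 1 ≤ r → r ≤ 3
    → Q k r (colCounts k x) ≡ colCounts k (T k r x)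
lemma2 k 3≤k x sorted r 1≤r r≤3 = tabulate-cong λ q →
  trans (applyQ≡updatedCount k (layerIndex 1≤r r≤3) 3≤k (entry (colCounts k x)) (s≤s z≤n) (toℕ<n q))
        (sym (ones-T≡updatedCount 3≤k x sorted r (s≤s z≤n) (toℕ<n q)))
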